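{- Let $b,g\in\omega^\omega$ with $b(i)\ge 2$ and $g(i)\ge1$ for all but finitely many $i$, let $\langle J_n\mid n<\omega\rangle$ be the interval partition of $\omega$ into consecutive intervals with $|J_n|=g(n)$, and define $f_{b,g}\in\omega^\omega$ by $f_{b,g}(k):=\sum_{\ell\le n}\lceil\log_2 b(\ell)\rceil$ whenever $k\in J_n$. If $f\in\omega^\omega$ is increasing and there is some $1\le m<\omega$ such that $f_{b,g}(k)\le f(k^m)$ for all but finitely many $k<\omega$, then $\mathbf{aLc}(b,g)^\perp\preceq_T\mathbf{Cv}(\mathcal{I}_f)$. In particular, $\mathfrak{c}^\exists_{b,g}\le\operatorname{cov}(\mathcal{I}_f)$ and $\operatorname{non}(\mathcal{I}_f)\le\mathfrak{v}^\exists_{b,g}$.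
   Context: Natural numbers are identified with $\{0,\dots,n-1\}$. $x\le^*y$ means $x(i)\le y(i)$ for all but finitely many $i$; $\mathrm{pow}_m(i)=i^m$; $g\gg f$ means $f\circ\mathrm{pow}_m\le^*g$ for every $m$. Yorioka ideals: for $\sigma\in(2^{<\omega})^\omega$, $[\sigma]_\infty:=\bigcap_m\bigcup_{i\ge m}\{x\in2^\omega\mid\sigma(i)\subseteq x\}$, $\mathrm{ht}_\sigma(i)=|\sigma(i)|$; $\mathcal{J}_{g'}:=\{X\subseteq2^\omega\mid\exists\sigma: X\subseteq[\sigma]_\infty,\ \mathrm{ht}_\sigma=g'\}$; for increasing $f$, $\mathcal{I}_f:=\bigcup_{g'\gg f}\mathcal{J}_{g'}$. $\operatorname{cov}(\mathcal{I}_f)$, $\operatorname{non}(\mathcal{I}_f)$ are the covering and uniformity numbers. $\mathbf{Cv}(\mathcal{I}_f):=\langle2^\omega,\mathcal{I}_f,\in\rangle$. Relational systems $\mathbf{R}=\langle X,Y,\sqsubset\rangle$; dual $\mathbf{R}^\perp=\langle Y,X,\not\sqsupset\rangle$ with $y\not\sqsupset x$ iff $\neg(x\sqsubset y)$; $\mathbf{R}\preceq_T\mathbf{R}'=\langle X',Y',\sqsubset'\rangle$ iff there are $F:X\to X'$, $G:Y'\to Y$ with $F(x)\sqsubset'y'\Rightarrow x\sqsubset G(y')$. $\prod b=\prod_i b(i)$, $\mathcal{S}(b,g)=\prod_i[b(i)]^{\le g(i)}$; $y\notin^\infty\varphi$ iff $y(i)\notin\varphi(i)$ for almost all $i$. $\mathbf{aLc}(b,g):=\langle\mathcal{S}(b,g),\prod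 b,R\rangle$, $\varphi Ry$ iff $y\notin^\infty\varphi$. $\mathfrak{c}^\exists_{b,g}:=\min\{|R_0|\mid R_0\subseteq\mathcal{S}(b,g),\ \neg\exists y\in\prod b\ \forall\varphi\in R_0: y\notin^\infty\varphi\}$; $\mathfrak{v}^\exists_{b,g}:=\min\{|E|\mid E\subseteq\prod b,\ \forall\varphi\in\mathcal{S}(b,g)\ \exists y\in E: y\notin^\infty\varphi\}$. -}

module Defs where

open import Level using (Level; _⊔_; suc; 0ℓ)
open import Data.Nat using (ℕ; zero; _+_; _≤_; _<_; _≥_; _^_)
  renaming (suc to sucℕ)
open import Data.Nat.Logarithm using (⌈log₂_⌉)
open import Data.Bool using (Bool)
open import Data.Fin using (Fin; toℕ)
open import Data.Fin.Subset using (Subset; _∈_; _∉_; ∣_∣)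
open import Data.Vec using (Vec; lookup)
open import Data.Product using (Σ; ∃; _×_; _,_; proj₁; proj₂)
open import Relation.Nullary using (¬_)
open import Relation.Binary.PropositionalEquality using (_≡_)

Eventually : (ℕ → Set) → Set
Eventually P = ∃ λ N → ∀ i → N ≤ i → P i

InfOften : (ℕ → Set) → Set
InfOften P = ∀ m → ∃ λ i → m ≤ i × P i

_≤*_ : (ℕ → ℕ) → (ℕ → ℕ) → Set
x ≤* y = Eventually (λ i → x i ≤ y i)

pow : ℕ → ℕ → ℕ
pow m i = i ^ m

_≫_ : (ℕ → ℕ) → (ℕ → ℕ) → Set
g ≫ f = ∀ m → (λ i → f (pow m i)) ≤* g

StrictlyIncreasing : (ℕ → ℕ) → Set
StrictlyIncreasing f = ∀ i j → i < j → f i < f j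

Cantor : Set
Cantor = ℕ → Bool

PSet : Set₁
PSet = Cantor → Set

_⊑_ : ∀ {n} → Vec Bool n → Cantor → Set
s ⊑ x = ∀ j → lookup s j ≡ x (toℕ j)

-- σ ∈ (2^{<ω})^ω with height function ht_σ = h
Seq : (ℕ → ℕ) → Set
Seq h = (i : ℕ) → Vec Bool (h i)

[_]∞ : ∀ {h} → Seq h → PSet
[ σ ]∞ x = InfOften (λ i → σ i ⊑ x)

InJ : (ℕ → ℕ) → PSet → Set
InJ h X = Σ (Seq h) λ σ → ∀ x → X x → [ σ ]∞ x

InI : (ℕ → ℕ) → PSet → Set
InI f X = Σ (ℕ → ℕ) λ h → h ≫ f × InJ h X

record RelSys (a b r : Level) : Set (Level.suc (a ⊔ b ⊔ r)) where
  field
    X   : Set a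
    Y   : Set b
    _⊏_ : X → Y → Set r

open RelSys public

_⊥ : ∀ {a b r} → RelSys a b r → RelSys b a r
R ⊥ = record { X = Y R ; Y = X R ; _⊏_ = λ y x → ¬ (_⊏_ R x y) }

_≼T_ : ∀ {a b r a' b' r'} → RelSys a b r → RelSys a' b' r' → Set (a ⊔ b ⊔ r ⊔ a' ⊔ b' ⊔ r')
R ≼T R' = Σ (X R → X R') λ F → Σ (Y R' → Y R) λ G →
  ∀ x y' → _⊏_ R' (F x) y' → _⊏_ R x (G y')

Prod : (b : ℕ → ℕ) → Set
Prod b = (i : ℕ) → Fin (b i)

Slalom : (b g : ℕ → ℕ) → Set
Slalom b g = Σ ((i : ℕ) → Subset (b i)) λ φ → ∀ i → ∣ φ i ∣ ≤ g i

_∉∞_ : ∀ {b g} → Prod b → Slalom b g → Set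
y ∉∞ φ = Eventually (λ i → y i ∉ proj₁ φ i)

aLc : (b g : ℕ → ℕ) → RelSys 0ℓ 0ℓ 0ℓ
aLc b g = record { X = Slalom b g ; Y = Prod b ; _⊏_ = λ φ y → y ∉∞ φ }

Cv-I : (f : ℕ → ℕ) → RelSys 0ℓ (Level.suc 0ℓ) 0ℓ
Cv-I f = record { X = Cantor ; Y = Σ PSet (InI f) ; _⊏_ = λ x A → proj₁ A x }

start : (ℕ → ℕ) → ℕ → ℕ
start g zero     = 0
start g (sucℕ n) = start g n + g n

InBlock : (g : ℕ → ℕ) → ℕ → ℕ → Set
InBlock g k n = start g n ≤ k × k < start g (sucℕ n)

sumLog : (ℕ → ℕ) → ℕ → ℕ
sumLog b zero     = ⌈log₂ b 0 ⌉
sumLog b (sucℕ n) = sumLog b n + ⌈log₂ b (sucℕ n) ⌉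

-- f_{b,g}(k) = sumLog b n  whenever k ∈ J_n;  "f_{b,g}(k) ≤ f(k^m) for almost all k"
FbgBound : (b g f : ℕ → ℕ) → ℕ → Set
FbgBound b g f m = Eventually (λ k → ∀ n → InBlock g k n → sumLog b n ≤ f (k ^ m))

module Submission where

-- Put L(ℓ) = ⌈log₂ b(ℓ)⌉, so every y(ℓ) < b(ℓ) has an L(ℓ)-digit binary
-- expansion, and f_{b,g}(k) = Σ_{ℓ≤n} L(ℓ) for k ∈ J_n.
-- F maps y ∈ ∏ b to the real in 2^ω concatenating the binary expansions of
-- y(0), y(1), … ; the expansion of y(n) (the n-th block) occupies the positions
-- [Σ_{ℓ<n} L(ℓ), Σ_{ℓ≤n} L(ℓ)).
-- G maps a set A ⊆ [σ]_∞ with ht_σ = h ≫ f to the slalom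
--   φ_σ(n) = { the number coded by the n-th block of σ(k) | k ∈ J_n },
-- which has at most |J_n| = g(n) elements.
-- If F(y) ∈ A then σ(k) ⊆ F(y) for arbitrarily large k.  For k ∈ J_n large,
-- Σ_{ℓ≤n} L(ℓ) ≤ f(k^m) ≤ h(k) = |σ(k)|, so σ(k) contains the whole n-th block
-- of F(y) and y(n) ∈ φ_σ(n); since n grows with k, y ∉^∞ φ_σ fails.
-- The file develops in turn: binary expansions, finite sets collected along
-- an interval, the block structure of F(y), the interval partition ⟨J_n⟩,
-- encoding and decoding, and finally the Tukey connection.

open import Defs
open import Data.Nat using (ℕ; _≤_; _<_)
open import Data.Product using (Σ; ∃; _×_)

open import Data.Nat using (zero; suc; _+_; _∸_; _^_; ⌊_/2⌋; ⌈_/2⌉; _<?_; _≤?_; z≤n; s≤s)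
open import Data.Nat.Properties
open import Data.Nat.Induction using (<-rec)
open import Data.Nat.Logarithm using (⌈log₂_⌉; ⌈log₂⌉-mono-≤; ⌈log₂2^n⌉≡n; ⌈log₂⌈n/2⌉⌉≡⌈log₂n⌉∸1)
open import Data.Bool using (Bool; true; false)
open import Data.Maybe using (Maybe; just; nothing)
open import Data.Fin using (Fin; toℕ; fromℕ<) renaming (zero to fzero; suc to fsuc)
open import Data.Fin.Properties using (fromℕ<-toℕ; toℕ<n)
open import Data.Fin.Subset using (Subset; inside; ∣_∣) renaming (_∈_ to _∈ₛ_; ⊥ to ∅)
open import Data.Fin.Subset.Properties using (∣⊥∣≡0)
open import Data.Vec using (Vec; []; _∷_; here; there)
open import Data.Product using (_,_; proj₁; proj₂)
open import Data.Sum using (inj₁; inj₂)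
open import Data.Empty using (⊥-elim)
open import Relation.Nullary using (¬_; yes; no)
open import Relation.Binary.PropositionalEquality

-- Binary expansions of natural numbers, least significant digit first.

parity : ℕ → Bool
parity zero          = false
parity (suc zero)    = true
parity (suc (suc c)) = parity c

bitValue : Bool → ℕ
bitValue false = 0
bitValue true  = 1

parity+2⌊/2⌋ : ∀ c → bitValue (parity c) + (⌊ c /2⌋ + ⌊ c /2⌋) ≡ c
parity+2⌊/2⌋ zero          = refl
parity+2⌊/2⌋ (suc zero)    = refl
parity+2⌊/2⌋ (suc (suc c)) = begin
  r + (suc h + suc h)     ≡⟨ cong (λ e → r + suc e) (+-suc h h) ⟩
  r + suc (suc (h + h))   ≡⟨ +-suc r (suc (h + h)) ⟩
  suc (r + suc (h + h))   ≡⟨ cong suc (+-suc r (h + h)) ⟩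
  suc (suc (r + (h + h))) ≡⟨ cong (λ e → suc (suc e)) (parity+2⌊/2⌋ c) ⟩
  suc (suc c)             ∎
  where
  open ≡-Reasoning
  r h : ℕ
  r = bitValue (parity c)
  h = ⌊ c /2⌋

digit : ℕ → ℕ → Bool
digit c zero    = parity c
digit c (suc j) = digit ⌊ c /2⌋ j

fromDigits : ℕ → (ℕ → Bool) → ℕ
fromDigits zero    d = 0
fromDigits (suc L) d = bitValue (d 0) + (v + v)
  where
  v : ℕ
  v = fromDigits L (λ j → d (suc j))

fromDigits-cong : ∀ L d d′ → (∀ j → j < L → d j ≡ d′ j) → fromDigits L d ≡ fromDigits L d′
fromDigits-cong zero    d d′ same = refl
fromDigits-cong (suc L) d d′ same =
  cong₂ (λ a v → bitValue a + (v + v)) (same 0 (s≤s z≤n))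
        (fromDigits-cong L _ _ (λ j j<L → same (suc j) (s≤s j<L)))

⌊/2⌋<2^ : ∀ L c → c < 2 ^ suc L → ⌊ c /2⌋ < 2 ^ L
⌊/2⌋<2^ L c c<2^1+L with ⌊ c /2⌋ <? 2 ^ L
... | yes h<2^L = h<2^L
... | no  h≮2^L = ⊥-elim (<⇒≱ c<2^1+L (begin
  2 ^ suc L                           ≡⟨ cong (2 ^ L +_) (+-identityʳ _) ⟩
  2 ^ L + 2 ^ L                       ≤⟨ +-mono-≤ (≮⇒≥ h≮2^L) (≮⇒≥ h≮2^L) ⟩
  ⌊ c /2⌋ + ⌊ c /2⌋                   ≤⟨ m≤n+m _ (bitValue (parity c)) ⟩
  bitValue (parity c) + (⌊ c /2⌋ + ⌊ c /2⌋) ≡⟨ parity+2⌊/2⌋ c ⟩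
  c                                   ∎))
  where open ≤-Reasoning

fromDigits-digit : ∀ L c → c < 2 ^ L → fromDigits L (digit c) ≡ c
fromDigits-digit zero    zero    _        = refl
fromDigits-digit zero    (suc c) (s≤s ())
fromDigits-digit (suc L) c       c<2^1+L  = begin
  bitValue (parity c) + (fromDigits L (digit ⌊ c /2⌋) + fromDigits L (digit ⌊ c /2⌋))
    ≡⟨ cong (λ v → bitValue (parity c) + (v + v)) (fromDigits-digit L ⌊ c /2⌋ (⌊/2⌋<2^ L c c<2^1+L)) ⟩
  bitValue (parity c) + (⌊ c /2⌋ + ⌊ c /2⌋) ≡⟨ parity+2⌊/2⌋ c ⟩
  c ∎
  where open ≡-Reasoning

-- ⌈log₂ n⌉ binary digits suffice for every number below n; by strong
-- induction, via ⌈log₂ ⌈n/2⌉⌉ = ⌈log₂ n⌉ ∸ 1.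
n≤2^⌈log₂n⌉ : ∀ n → n ≤ 2 ^ ⌈log₂ n ⌉
n≤2^⌈log₂n⌉ = <-rec (λ n → n ≤ 2 ^ ⌈log₂ n ⌉) step
  where
  step : ∀ n → (∀ {m} → m < n → m ≤ 2 ^ ⌈log₂ m ⌉) → n ≤ 2 ^ ⌈log₂ n ⌉
  step zero          _  = z≤n
  step (suc zero)    _  = m^n>0 2 ⌈log₂ 1 ⌉
  step (suc (suc k)) ih = begin
    n                           ≡⟨ sym (⌊n/2⌋+⌈n/2⌉≡n n) ⟩
    ⌊ n /2⌋ + ⌈ n /2⌉           ≤⟨ +-monoˡ-≤ _ (⌊n/2⌋≤⌈n/2⌉ n) ⟩
    ⌈ n /2⌉ + ⌈ n /2⌉           ≤⟨ +-mono-≤ half≤ half≤ ⟩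
    2 ^ (L ∸ 1) + 2 ^ (L ∸ 1)   ≡⟨ cong (2 ^ (L ∸ 1) +_) (sym (+-identityʳ _)) ⟩
    2 ^ suc (L ∸ 1)             ≡⟨ cong (2 ^_) (m+[n∸m]≡n 1≤L) ⟩
    2 ^ L                       ∎
    where
    open ≤-Reasoning
    n L : ℕ
    n = suc (suc k)
    L = ⌈log₂ n ⌉
    half≤ : ⌈ n /2⌉ ≤ 2 ^ (L ∸ 1)
    half≤ = subst (λ e → ⌈ n /2⌉ ≤ 2 ^ e) (⌈log₂⌈n/2⌉⌉≡⌈log₂n⌉∸1 n) (ih (⌈n/2⌉<n k))
    1≤L : 1 ≤ L
    1≤L = subst (_≤ L) (⌈log₂2^n⌉≡n 1) (⌈log₂⌉-mono-≤ {2 ^ 1} {n} (s≤s (s≤s z≤n)))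

1≤⌈log₂⌉ : ∀ {b} → 2 ≤ b → 1 ≤ ⌈log₂ b ⌉
1≤⌈log₂⌉ {b} 2≤b = subst (_≤ ⌈log₂ b ⌉) (⌈log₂2^n⌉≡n 1) (⌈log₂⌉-mono-≤ {2 ^ 1} {b} 2≤b)

-- Finite sets of values collected along an interval of indices; they
-- become the sets φ(n) of the slalom.

insert : ∀ {B} → Fin B → Subset B → Subset B
insert fzero    (_ ∷ p) = inside ∷ p
insert (fsuc x) (s ∷ p) = s ∷ insert x p

insert-size : ∀ {B} (x : Fin B) (p : Subset B) → ∣ insert x p ∣ ≤ suc ∣ p ∣
insert-size fzero    (true  ∷ p) = n≤1+n _
insert-size fzero    (false ∷ p) = ≤-refl
insert-size (fsuc x) (true  ∷ p) = s≤s (insert-size x p)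
insert-size (fsuc x) (false ∷ p) = insert-size x p

insert-new : ∀ {B} (x : Fin B) (p : Subset B) → x ∈ₛ insert x p
insert-new fzero    (_ ∷ p) = here
insert-new (fsuc x) (s ∷ p) = there (insert-new x p)

insert-old : ∀ {B} (x y : Fin B) (p : Subset B) → y ∈ₛ p → y ∈ₛ insert x p
insert-old fzero    fzero    (_ ∷ p) here      = here
insert-old fzero    (fsuc y) (_ ∷ p) (there m) = there m
insert-old (fsuc x) fzero    (s ∷ p) here      = here
insert-old (fsuc x) (fsuc y) (s ∷ p) (there m) = there (insert-old x y p m)

insertMaybe : ∀ {B} → Maybe (Fin B) → Subset B → Subset B
insertMaybe nothing  p = p
insertMaybe (just x) p = insert x p

insertMaybe-size : ∀ {B} (x : Maybe (Fin B)) (p : Subset B) →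
                   ∣ insertMaybe x p ∣ ≤ suc ∣ p ∣
insertMaybe-size nothing  p = n≤1+n _
insertMaybe-size (just x) p = insert-size x p

insertMaybe-old : ∀ {B} (x : Maybe (Fin B)) y (p : Subset B) → y ∈ₛ p → y ∈ₛ insertMaybe x p
insertMaybe-old nothing  y p y∈p = y∈p
insertMaybe-old (just x) y p y∈p = insert-old x y p y∈p

collect : ∀ {B} → (ℕ → Maybe (Fin B)) → ℕ → ℕ → Subset B
collect e a zero    = ∅
collect e a (suc c) = insertMaybe (e a) (collect e (suc a) c)

collect-size : ∀ {B} (e : ℕ → Maybe (Fin B)) a c → ∣ collect e a c ∣ ≤ c
collect-size {B} e a zero    = ≤-reflexive (∣⊥∣≡0 B)
collect-size     e a (suc c) = ≤-trans (insertMaybe-size (e a) _) (s≤s (collect-size e (suc a) c))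

collect-∈ : ∀ {B} (e : ℕ → Maybe (Fin B)) a c k v →
            a ≤ k → k < a + c → e k ≡ just v → v ∈ₛ collect e a c
collect-∈ e a zero    k v a≤k k<a+0 _ = ⊥-elim (<⇒≱ k<a+0 (subst (_≤ k) (sym (+-identityʳ a)) a≤k))
collect-∈ e a (suc c) k v a≤k k<a+c ek≡v with m≤n⇒m<n∨m≡n a≤k
... | inj₂ refl rewrite ek≡v = insert-new v _
... | inj₁ a<k = insertMaybe-old (e a) v _
                   (collect-∈ e (suc a) c k v a<k (subst (k <_) (+-suc a c) k<a+c) ek≡v)

-- The block structure of the code of y ∈ ∏ b.

-- The n-th block occupies the positions [blockStart b n, sumLog b n),
-- i.e. it has length ⌈log₂ b(n)⌉.
blockStart : (ℕ → ℕ) → ℕ → ℕ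
blockStart b zero    = 0
blockStart b (suc n) = sumLog b n

blockEnd≡ : ∀ b n → sumLog b n ≡ blockStart b n + ⌈log₂ b n ⌉
blockEnd≡ b zero    = refl
blockEnd≡ b (suc n) = refl

sumLog-mono : ∀ b {n m} → n ≤ m → sumLog b n ≤ sumLog b m
sumLog-mono b {m = zero}  z≤n = ≤-refl
sumLog-mono b {m = suc m} n≤1+m with m≤n⇒m<n∨m≡n n≤1+m
... | inj₂ refl      = ≤-refl
... | inj₁ (s≤s n≤m) = ≤-trans (sumLog-mono b n≤m) (m≤m+n _ _)

sumLog≤blockStart : ∀ b {n m} → n < m → sumLog b n ≤ blockStart b m
sumLog≤blockStart b {m = suc m} (s≤s n≤m) = sumLog-mono b n≤m

-- Once b(i) ≥ 2 for i ≥ N₀, every block from N₀ on is nonempty, so the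
-- index of a block is bounded by its starting position plus N₀.
n≤blockStart+N₀ : ∀ b N₀ → (∀ i → N₀ ≤ i → 2 ≤ b i) → ∀ n → n ≤ blockStart b n + N₀
n≤blockStart+N₀ b N₀ b≥2 zero    = z≤n
n≤blockStart+N₀ b N₀ b≥2 (suc n) with N₀ ≤? n
... | no  N₀≰n = ≤-trans (≰⇒> N₀≰n) (m≤n+m N₀ (sumLog b n))
... | yes N₀≤n = begin
  suc n                             ≤⟨ s≤s (n≤blockStart+N₀ b N₀ b≥2 n) ⟩
  suc (blockStart b n + N₀)         ≡⟨ sym (+-suc (blockStart b n) N₀) ⟩
  blockStart b n + suc N₀           ≤⟨ +-monoʳ-≤ (blockStart b n) (+-monoˡ-≤ N₀ (1≤⌈log₂⌉ (b≥2 n N₀≤n))) ⟩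
  blockStart b n + (⌈log₂ b n ⌉ + N₀) ≡⟨ sym (+-assoc (blockStart b n) _ N₀) ⟩
  blockStart b n + ⌈log₂ b n ⌉ + N₀   ≡⟨ cong (_+ N₀) (sym (blockEnd≡ b n)) ⟩
  sumLog b n + N₀                   ∎
  where open ≤-Reasoning

-- blockOf b fuel n j : the first of the blocks n, n+1, …, n+fuel-1 ending
-- after position j (a search of bounded length, since blocks may be empty).
blockOf : (ℕ → ℕ) → ℕ → ℕ → ℕ → ℕ
blockOf b zero       n j = n
blockOf b (suc fuel) n j with j <? sumLog b n
... | yes _ = n
... | no  _ = blockOf b fuel (suc n) j

blockOf-correct : ∀ b fuel n m j → n ≤ m → m < n + fuel →
                  blockStart b m ≤ j → j < sumLog b m → blockOf b fuel n j ≡ m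
blockOf-correct b zero n m j n≤m m<n+0 _ _ =
  ⊥-elim (<⇒≱ m<n+0 (subst (_≤ m) (sym (+-identityʳ n)) n≤m))
blockOf-correct b (suc fuel) n m j n≤m m<n+fuel start≤j j<end with j <? sumLog b n | m≤n⇒m<n∨m≡n n≤m
... | yes _      | inj₂ refl = refl
... | yes j<endₙ | inj₁ n<m  = ⊥-elim (<⇒≱ j<endₙ (≤-trans (sumLog≤blockStart b n<m) start≤j))
... | no  j≮end  | inj₂ refl = ⊥-elim (j≮end j<end)
... | no  _      | inj₁ n<m  =
  blockOf-correct b fuel (suc n) m j n<m (subst (m <_) (+-suc n fuel) m<n+fuel) start≤j j<end

start-mono : ∀ g {n m} → n ≤ m → start g n ≤ start g m
start-mono g {m = zero}  z≤n = ≤-refl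
start-mono g {m = suc m} n≤1+m with m≤n⇒m<n∨m≡n n≤1+m
... | inj₂ refl      = ≤-refl
... | inj₁ (s≤s n≤m) = ≤-trans (start-mono g n≤m) (m≤m+n _ _)

start-grows : ∀ g K → (∀ i → K ≤ i → 1 ≤ g i) → ∀ t → start g K + t ≤ start g (t + K)
start-grows g K g≥1 zero    = ≤-reflexive (+-identityʳ _)
start-grows g K g≥1 (suc t) = begin
  start g K + suc t        ≡⟨ +-suc _ t ⟩
  suc (start g K + t)      ≤⟨ s≤s (start-grows g K g≥1 t) ⟩
  suc (start g (t + K))    ≡⟨ +-comm 1 _ ⟩
  start g (t + K) + 1      ≤⟨ +-monoʳ-≤ (start g (t + K)) (g≥1 (t + K) (m≤n+m K t)) ⟩
  start g (suc t + K)      ∎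
  where open ≤-Reasoning hiding (start)

block-below : ∀ g M k → k < start g M → ∃ λ n → InBlock g k n
block-below g zero    k ()
block-below g (suc M) k k<end with k <? start g M
... | yes k<start = block-below g M k k<start
... | no  k≮start = M , ≮⇒≥ k≮start , k<end

block-of : ∀ g → Eventually (λ i → 1 ≤ g i) → ∀ k → ∃ λ n → InBlock g k n
block-of g (K , g≥1) k =
  block-below g (suc k + K) k (≤-trans (m≤n+m (suc k) (start g K)) (start-grows g K g≥1 (suc k)))

block-index≥ : ∀ g {N n k} → start g N ≤ k → InBlock g k n → N ≤ n
block-index≥ g {N} {n} startN≤k (_ , k<end) with N ≤? n
... | yes N≤n = N≤n
... | no  N≰n = ⊥-elim (<⇒≱ k<end (≤-trans (start-mono g (≰⇒> N≰n)) startN≤k))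

-- Encoding y ∈ ∏ b as a real, and decoding blocks of finite sequences.

-- The real whose n-th block is the binary expansion of y(n).  The search
-- for the block of position j needs at most j + N₀ + 1 steps.
encode : (b : ℕ → ℕ) → ℕ → Prod b → Cantor
encode b N₀ y j = digit (toℕ (y n)) (j ∸ blockStart b n)
  where
  n : ℕ
  n = blockOf b (suc (j + N₀)) 0 j

encode-block : ∀ b N₀ → (∀ i → N₀ ≤ i → 2 ≤ b i) → ∀ y n t → t < ⌈log₂ b n ⌉ →
               encode b N₀ y (blockStart b n + t) ≡ digit (toℕ (y n)) t
encode-block b N₀ b≥2 y n t t<L = begin
  digit (toℕ (y (blockOf b (suc (j + N₀)) 0 j))) (j ∸ blockStart b (blockOf b (suc (j + N₀)) 0 j))
    ≡⟨ cong (λ n′ → digit (toℕ (y n′)) (j ∸ blockStart b n′)) blockOf-found ⟩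
  digit (toℕ (y n)) (j ∸ blockStart b n) ≡⟨ cong (digit (toℕ (y n))) (m+n∸m≡n (blockStart b n) t) ⟩
  digit (toℕ (y n)) t                    ∎
  where
  open ≡-Reasoning
  j : ℕ
  j = blockStart b n + t
  blockOf-found : blockOf b (suc (j + N₀)) 0 j ≡ n
  blockOf-found = blockOf-correct b (suc (j + N₀)) 0 n j z≤n
    (s≤s (≤-trans (n≤blockStart+N₀ b N₀ b≥2 n) (+-monoˡ-≤ N₀ (m≤m+n _ t))))
    (m≤m+n _ t)
    (subst (j <_) (sym (blockEnd≡ b n)) (+-monoʳ-< (blockStart b n) t<L))

-- Total read access to a finite binary sequence (false outside its range).
bitAt : ∀ {h} → Vec Bool h → ℕ → Bool
bitAt []      _       = false
bitAt (a ∷ s) zero    = a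
bitAt (a ∷ s) (suc p) = bitAt s p

bitAt-⊑ : ∀ {h} (s : Vec Bool h) (x : Cantor) p → p < h → s ⊑ x → bitAt s p ≡ x p
bitAt-⊑ (a ∷ s) x zero    _         s⊑x = s⊑x fzero
bitAt-⊑ (a ∷ s) x (suc p) (s≤s p<h) s⊑x = bitAt-⊑ s (λ i → x (suc i)) p p<h (λ j → s⊑x (fsuc j))

toFin : ∀ B → ℕ → Maybe (Fin B)
toFin B c with c <? B
... | yes c<B = just (fromℕ< c<B)
... | no  _   = nothing

toFin-toℕ : ∀ B (v : Fin B) → toFin B (toℕ v) ≡ just v
toFin-toℕ B v with toℕ v <? B
... | yes v<B = cong just (fromℕ<-toℕ v v<B)
... | no  v≮B = ⊥-elim (v≮B (toℕ<n v))

decode : (b : ℕ → ℕ) (n : ℕ) → ∀ {h} → Vec Bool h → Maybe (Fin (b n))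
decode b n s = toFin (b n) (fromDigits ⌈log₂ b n ⌉ (λ t → bitAt s (blockStart b n + t)))

decode-encode : ∀ b N₀ → (∀ i → N₀ ≤ i → 2 ≤ b i) → ∀ y n {h} (s : Vec Bool h) →
                sumLog b n ≤ h → s ⊑ encode b N₀ y → decode b n s ≡ just (y n)
decode-encode b N₀ b≥2 y n s end≤h s⊑y = begin
  toFin (b n) (fromDigits L (λ t → bitAt s (blockStart b n + t))) ≡⟨ cong (toFin (b n)) (fromDigits-cong L _ _ read-block) ⟩
  toFin (b n) (fromDigits L (digit (toℕ (y n))))                 ≡⟨ cong (toFin (b n)) (fromDigits-digit L _ yn<2^L) ⟩
  toFin (b n) (toℕ (y n))                                        ≡⟨ toFin-toℕ (b n) (y n) ⟩
  just (y n)                                                     ∎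
  where
  open ≡-Reasoning
  L : ℕ
  L = ⌈log₂ b n ⌉
  read-block : ∀ t → t < L → bitAt s (blockStart b n + t) ≡ digit (toℕ (y n)) t
  read-block t t<L = trans
    (bitAt-⊑ s (encode b N₀ y) (blockStart b n + t)
      (<-≤-trans (subst (blockStart b n + t <_) (sym (blockEnd≡ b n)) (+-monoʳ-< (blockStart b n) t<L)) end≤h) s⊑y)
    (encode-block b N₀ b≥2 y n t t<L)
  yn<2^L : toℕ (y n) < 2 ^ L
  yn<2^L = <-≤-trans (toℕ<n (y n)) (n≤2^⌈log₂n⌉ (b n))

slalomOf : (b g : ℕ → ℕ) → ∀ {h} → Seq h → Slalom b g
slalomOf b g σ = (λ n → collect (λ k → decode b n (σ k)) (start g n) (g n))
               , (λ n → collect-size _ _ _)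

slalomOf-catches : ∀ b g N₀ → (∀ i → N₀ ≤ i → 2 ≤ b i) → ∀ {h} (σ : Seq h) y k n →
                   InBlock g k n → sumLog b n ≤ h k → σ k ⊑ encode b N₀ y →
                   y n ∈ₛ proj₁ (slalomOf b g σ) n
slalomOf-catches b g N₀ b≥2 σ y k n (start≤k , k<end) end≤h σk⊑y =
  collect-∈ _ (start g n) (g n) k (y n) start≤k k<end (decode-encode b N₀ b≥2 y n (σ k) end≤h σk⊑y)

-- The Tukey connection: F = encode, G reads the slalom φ_σ off a witness
-- A ⊆ [σ]_∞ of A ∈ I_f.
lemma2p5 : (b g f : ℕ → ℕ) →
    Eventually (λ i → 2 ≤ b i) → Eventually (λ i → 1 ≤ g i) →
    StrictlyIncreasing f →
    (∃ λ m → 1 ≤ m × FbgBound b g f m) →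
    (aLc b g ⊥) ≼T Cv-I f
lemma2p5 b g f (N₀ , b≥2) g≥1 _ (m , _ , (K₂ , fbg≤f)) = encode b N₀ , G , connection
  where
  G : Σ PSet (InI f) → Slalom b g
  G (_ , _ , _ , σ , _) = slalomOf b g σ

  connection : ∀ y A → proj₁ A (encode b N₀ y) → ¬ (y ∉∞ G A)
  connection y (_ , h , h≫f , σ , A⊆[σ]) yA (N , avoids)
    with h≫f m | A⊆[σ] _ yA (start g N + (proj₁ (h≫f m) + K₂))
  ... | K₁ , f≤h | k , k≥ , σk⊑y =
    avoids n (block-index≥ g (≤-trans (m≤m+n _ _) k≥) k∈Jₙ)
      (slalomOf-catches b g N₀ b≥2 σ y k n k∈Jₙ end≤h σk⊑y)
    where
    n : ℕ
    n = proj₁ (block-of g g≥1 k)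
    k∈Jₙ : InBlock g k n
    k∈Jₙ = proj₂ (block-of g g≥1 k)
    K₁≤k : K₁ ≤ k
    K₁≤k = ≤-trans (≤-trans (m≤m+n K₁ K₂) (m≤n+m _ (start g N))) k≥
    K₂≤k : K₂ ≤ k
    K₂≤k = ≤-trans (≤-trans (m≤n+m K₂ K₁) (m≤n+m _ (start g N))) k≥
    -- f_{b,g}(k) ≤ f(k^m) ≤ h(k) = |σ(k)|
    end≤h : sumLog b n ≤ h k
    end≤h = ≤-trans (fbg≤f k K₂≤k n k∈Jₙ) (f≤h k K₁≤k)
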